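{- Let $p$ and $q$ be positive integers. A graph $G$ is hereditary $(p,q)$-biclique-Helly if and only if its biclique hypergraph $\mathcal B(G)$ is hereditary $(p,q)$-Helly.
   Context: Graphs are finite, simple and undirected. A graph is complete bipartite if its vertex set can be partitioned into two (possibly empty) stable sets with every vertex of one adjacent to every vertex of the other (edgeless graphs count as complete bipartite); a biclique is a vertex set inducing a complete bipartite graph; maximal means inclusion-wise maximal. The core of a family of sets is the intersection of its members. A family is $(p,q)$-intersecting if every nonempty subfamily of at most $p$ members has core of cardinality at least $q$, and has the $(p,q)$-Helly property if every nonempty $(p,q)$-intersecting subfamily has core of cardinality at least $q$. A graph is $(p,q)$-biclique-Helly if the family of its maximal bicliques has the $(p,q)$-Helly property, and hereditary $(p,q)$-biclique-Helly if every induced subgraph is $(p,q)$-biclique-Helly. A hypergraph is a finite vertex set $X$ with a finite family of nonempty subsets (edges) whose union is $X$; it is $(p,q)$-Helly if its edge family has the $(p,q)$-Helly property; for $X'\subseteq X$ the subhypergraph induced by $X'$ has vertex set $X'$ and edges the nonempty intersections of edges with $X'$; a hypergraph is hereditary $(p,q)$-Helly if all its subhypergraphs are $(p,q)$-Helly. $\mathcal B(G)$ has vertex set $V(G)$ and edges the maximal bicliques of $G$. -}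

module Defs where

open import Data.Nat using (ℕ; _≤_)
open import Data.Fin using (Fin)
open import Data.Fin.Subset using (Subset; _∈_; _⊆_; Nonempty)
open import Data.Vec using (tabulate; lookup)
open import Data.Product using (Σ; ∃; _×_)
open import Data.Sum using (_⊎_)
open import Data.Empty using (⊥)
open import Relation.Nullary using (¬_; Dec)
open import Relation.Binary.PropositionalEquality using (_≡_)
open import Function.Definitions using (Injective)
open import Function.Bundles using (_⇔_)

record Graph (n : ℕ) : Set₁ where
  field
    Adj    : Fin n → Fin n → Set
    adj?   : ∀ x y → Dec (Adj x y)
    sym    : ∀ {x y} → Adj x y → Adj y x
    irrefl : ∀ {x} → ¬ Adj x x
open Graph public

-- Induced subgraph along an injection f : Fin m → Fin n (every induced
-- subgraph of G is, up to isomorphism, of this form).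
induce : ∀ {n m} → Graph n → (Fin m → Fin n) → Graph m
induce G f = record
  { Adj = λ x y → Adj G (f x) (f y)
  ; adj? = λ x y → adj? G (f x) (f y)
  ; sym = sym G
  ; irrefl = irrefl G
  }

Family : ℕ → Set₁
Family n = Subset n → Set

core : ∀ {n} → Family n → Fin n → Set
core F x = ∀ A → F A → x ∈ A

AtLeast : ∀ {n} → ℕ → (Fin n → Set) → Set
AtLeast {n} q P = Σ (Fin q → Fin n) λ g → Injective _≡_ _≡_ g × (∀ i → P (g i))

-- (p,q)-intersecting: every nonempty subfamily of at most p members
-- (given as an indexed list A₀ … A_{k-1}, 1 ≤ k ≤ p, of members)
-- has core of cardinality at least q.
Intersecting : ∀ {n} → ℕ → ℕ → Family n → Set
Intersecting {n} p q F =
  ∀ (k : ℕ) → 1 ≤ k → k ≤ p → (A : Fin k → Subset n) → (∀ i → F (A i)) →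
  AtLeast q (λ x → ∀ i → x ∈ A i)

Helly : ∀ {n} → ℕ → ℕ → Family n → Set₁
Helly {n} p q F =
  ∀ (F' : Family n) → (∀ A → F' A → F A) → (∃ λ A → F' A) →
  Intersecting p q F' → AtLeast q (core F')

record IsHypergraph {n : ℕ} (E : Family n) : Set where
  field
    edges-nonempty : ∀ A → E A → Nonempty A
    covers         : ∀ x → ∃ λ A → E A × x ∈ A

preimage : ∀ {n m} → (Fin m → Fin n) → Subset n → Subset m
preimage f A = tabulate (λ i → lookup A (f i))

-- edges of the subhypergraph induced by the vertex subset f(Fin m)
-- (identified with Fin m via the injection f): the nonempty traces.
inducedEdges : ∀ {n m} → (Fin m → Fin n) → Family n → Family m
inducedEdges f E B = (∃ λ A → E A × B ≡ preimage f A) × Nonempty B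

HellyHyp : ∀ {n} → ℕ → ℕ → Family n → Set₁
HellyHyp p q E = Helly p q E

HereditaryHelly : ∀ {n} → ℕ → ℕ → Family n → Set₁
HereditaryHelly {n} p q E =
  ∀ (m : ℕ) (f : Fin m → Fin n) → Injective _≡_ _≡_ f →
  HellyHyp p q (inducedEdges f E)

Stable : ∀ {n} → Graph n → Subset n → Set
Stable G S = ∀ {x y} → x ∈ S → y ∈ S → ¬ Adj G x y

-- B induces a complete bipartite graph (parts possibly empty)
IsBiclique : ∀ {n} → Graph n → Subset n → Set
IsBiclique G B = ∃ λ S → ∃ λ T →
  (∀ x → (x ∈ B → x ∈ S ⊎ x ∈ T) × (x ∈ S ⊎ x ∈ T → x ∈ B)) ×
  (∀ x → x ∈ S → x ∈ T → ⊥) ×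
  Stable G S × Stable G T ×
  (∀ {x y} → x ∈ S → y ∈ T → Adj G x y)

IsMaximalBiclique : ∀ {n} → Graph n → Subset n → Set
IsMaximalBiclique G B =
  IsBiclique G B × (∀ B' → IsBiclique G B' → B ⊆ B' → B' ⊆ B)

𝓑 : ∀ {n} → Graph n → Family n
𝓑 G = IsMaximalBiclique G

BicliqueHelly : ∀ {n} → ℕ → ℕ → Graph n → Set₁
BicliqueHelly p q G = Helly p q (IsMaximalBiclique G)

HereditaryBicliqueHelly : ∀ {n} → ℕ → ℕ → Graph n → Set₁
HereditaryBicliqueHelly {n} p q G =
  ∀ (m : ℕ) (f : Fin m → Fin n) → Injective _≡_ _≡_ f →
  BicliqueHelly p q (induce G f)

{-# OPTIONS --safe #-}
module Submission where

-- Every maximal biclique of an induced subgraph G[W] is the trace on W of a maximal biclique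
-- of G; this gives one direction. For the other, let F be a (p,q)-intersecting family of
-- traces on X and let 𝓜 (Supporting) be the maximal bicliques of G containing some member of F.
-- Whenever X ⊆ W and every vertex outside W lies in all of 𝓜, the traces of 𝓜 on W are maximal
-- bicliques of G[W] and form a (p,q)-intersecting family, so they have q common vertices. If all
-- of these lie in X they are common to F; otherwise one of them lies outside X and in all of 𝓜,
-- so it can be deleted from W. Starting from W = V(G), this process ends with the first case.

open import Defs hiding (sym)
open import Data.Nat using (ℕ; _≤_; zero; suc; s≤s; z≤n)
open import Data.Bool using (Bool; true)
open import Data.Fin using (Fin; zero; punchIn; punchOut)
open import Data.Fin.Properties using (any?; all?; _≟_; punchIn-injective; punchIn-punchOut; ¬∀⟶∃¬)
open import Data.Fin.Subset using (Subset; _∈_; _⊆_; Nonempty; _∪_; _∩_; ⁅_⁆)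
open import Data.Fin.Subset.Properties
  using (_∈?_; anySubset?; x∈p∪q⁺; x∈p∪q⁻; x∈⁅x⁆; x∈⁅y⁆⇒x≡y; x∈p∩q⁺; p∩q⊆p; p∩q⊆q; ⊆-antisym)
open import Data.Vec using (tabulate; lookup)
open import Data.Vec.Properties using (lookup∘tabulate; []=⇒lookup; lookup⇒[]=)
open import Data.List using (List; []; _∷_; allFin)
open import Data.List.Relation.Unary.Any using (here; there)
import Data.List.Membership.Propositional as List
open import Data.List.Membership.Propositional.Properties using (∈-allFin)
open import Data.Product using (∃; _×_; _,_; proj₁; proj₂)
open import Data.Sum using (_⊎_; inj₁; inj₂; [_,_])
open import Data.Empty using (⊥; ⊥-elim)
open import Function using (id)
open import Function.Bundles using (_⇔_; mk⇔)
open import Function.Definitions using (Injective)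
open import Relation.Nullary using (¬_; Dec; yes; no; does; ¬?)
open import Relation.Nullary.Decidable using (_×-dec_; _⊎-dec_; _→-dec_; map′; dec-true)
open import Level using (0ℓ)
open import Relation.Unary using (Pred; Decidable)
open import Relation.Binary.PropositionalEquality using (_≡_; _≢_; refl; sym; trans; cong; subst)

∈-tabulate⁺ : ∀ {n} (h : Fin n → Bool) {x} → h x ≡ true → x ∈ tabulate h
∈-tabulate⁺ h {x} hx = lookup⇒[]= x (tabulate h) (trans (lookup∘tabulate h x) hx)

∈-tabulate⁻ : ∀ {n} (h : Fin n → Bool) {x} → x ∈ tabulate h → h x ≡ true
∈-tabulate⁻ h {x} x∈ = trans (sym (lookup∘tabulate h x)) ([]=⇒lookup x∈)

∈-preimage⁺ : ∀ {m n} (g : Fin m → Fin n) {A x} → g x ∈ A → x ∈ preimage g A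
∈-preimage⁺ g gx∈A = ∈-tabulate⁺ _ ([]=⇒lookup gx∈A)

∈-preimage⁻ : ∀ {m n} (g : Fin m → Fin n) {A x} → x ∈ preimage g A → g x ∈ A
∈-preimage⁻ g {A} {x} x∈ = lookup⇒[]= (g x) A (∈-tabulate⁻ _ x∈)

subsetOf : ∀ {n} {P : Pred (Fin n) 0ℓ} → Decidable P → Subset n
subsetOf P? = tabulate (λ x → does (P? x))

module _ {n} {P : Pred (Fin n) 0ℓ} (P? : Decidable P) where

  ∈-subsetOf⁺ : ∀ {x} → P x → x ∈ subsetOf P?
  ∈-subsetOf⁺ {x} px = ∈-tabulate⁺ _ (dec-true (P? x) px)

  ∈-subsetOf⁻ : ∀ {x} → x ∈ subsetOf P? → P x
  ∈-subsetOf⁻ {x} x∈ = does-true⇒ (P? x) (∈-tabulate⁻ _ x∈)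
    where
    does-true⇒ : ∀ {A : Set} (a? : Dec A) → does a? ≡ true → A
    does-true⇒ (yes a) _ = a

module _ {m n} (g : Fin m → Fin n) where

  hits? : (B : Subset m) → Decidable (λ v → ∃ λ y → y ∈ B × g y ≡ v)
  hits? B v = any? (λ y → (y ∈? B) ×-dec (g y ≟ v))

  image : Subset m → Subset n
  image B = subsetOf (hits? B)

  ∈-image⁺ : ∀ {B y} → y ∈ B → g y ∈ image B
  ∈-image⁺ {B} {y} y∈B = ∈-subsetOf⁺ (hits? B) (y , y∈B , refl)

  ∈-image⁻ : ∀ {B v} → v ∈ image B → ∃ λ y → y ∈ B × g y ≡ v
  ∈-image⁻ {B} = ∈-subsetOf⁻ (hits? B)

∪-⁅⁆-⊆ : ∀ {n} {B B' : Subset n} {v} → B ⊆ B' → v ∈ B' → B ∪ ⁅ v ⁆ ⊆ B'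
∪-⁅⁆-⊆ {B = B} {B'} {v} B⊆B' v∈B' x∈ =
  [ B⊆B' , (λ x∈v → subst (_∈ B') (sym (x∈⁅y⁆⇒x≡y v x∈v)) v∈B') ] (x∈p∪q⁻ B ⁅ v ⁆ x∈)

atLeast⇒nonempty : ∀ {n q} {P : Fin n → Set} → 1 ≤ q → AtLeast q P → ∃ P
atLeast⇒nonempty (s≤s z≤n) (h , _ , Ph) = h zero , Ph zero

atLeast-map : ∀ {m n q} {P : Fin m → Set} {Q : Fin n → Set} (c : Fin m → Fin n) →
              Injective _≡_ _≡_ c → (∀ {x} → P x → Q (c x)) → AtLeast q P → AtLeast q Q
atLeast-map c c-inj P⇒Q (h , h-inj , Ph) = (λ i → c (h i)) , (λ e → h-inj (c-inj e)) , (λ i → P⇒Q (Ph i))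

atLeast-pullback : ∀ {m n q} {P : Fin n → Set} {Q : Fin m → Set} (c : Fin m → Fin n) →
                   (∀ {x} → P (c x) → Q x) → (L : AtLeast q P) →
                   (∀ i → ∃ λ x → c x ≡ proj₁ L i) → AtLeast q Q
atLeast-pullback {P = P} c P∘c⇒Q (h , h-inj , Ph) lift =
  (λ i → proj₁ (lift i)) ,
  (λ {i} {j} e → h-inj (trans (sym (proj₂ (lift i))) (trans (cong c e) (proj₂ (lift j))))) ,
  (λ i → P∘c⇒Q (subst P (sym (proj₂ (lift i))) (Ph i)))

intersecting⇒nonempty : ∀ {n p q} {F : Family n} → 1 ≤ p → 1 ≤ q →
                        Intersecting p q F → ∀ {A} → F A → Nonempty A
intersecting⇒nonempty 1≤p 1≤q F-int {A} FA
  with atLeast⇒nonempty {P = λ x → ∀ i → x ∈ A} 1≤q (F-int 1 (s≤s z≤n) 1≤p (λ _ → A) (λ _ → FA))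
... | x , x∈A = x , x∈A zero

module _ {n} (G : Graph n) where

  Complete : Subset n → Subset n → Set
  Complete S T = ∀ {x y} → x ∈ S → y ∈ T → Adj G x y

  IsCompleteBipartition : Subset n → Subset n → Subset n → Set
  IsCompleteBipartition B S T =
    (∀ x → (x ∈ B → x ∈ S ⊎ x ∈ T) × (x ∈ S ⊎ x ∈ T → x ∈ B)) ×
    (∀ x → x ∈ S → x ∈ T → ⊥) × Stable G S × Stable G T × Complete S T

  stable? : ∀ S → Dec (Stable G S)
  stable? S = map′ (λ f {x} {y} → f x y) (λ f x y → f {x} {y})
    (all? λ x → all? λ y → (x ∈? S) →-dec ((y ∈? S) →-dec ¬? (adj? G x y)))

  complete? : ∀ S T → Dec (Complete S T)
  complete? S T = map′ (λ f {x} {y} → f x y) (λ f x y → f {x} {y})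
    (all? λ x → all? λ y → (x ∈? S) →-dec ((y ∈? T) →-dec adj? G x y))

  isCompleteBipartition? : ∀ B S T → Dec (IsCompleteBipartition B S T)
  isCompleteBipartition? B S T =
    all? (λ x → ((x ∈? B) →-dec ((x ∈? S) ⊎-dec (x ∈? T))) ×-dec
                (((x ∈? S) ⊎-dec (x ∈? T)) →-dec (x ∈? B)))
    ×-dec all? (λ x → (x ∈? S) →-dec ¬? (x ∈? T))
    ×-dec stable? S ×-dec stable? T ×-dec complete? S T

  isBiclique? : ∀ B → Dec (IsBiclique G B)
  isBiclique? B = anySubset? λ S → anySubset? λ T → isCompleteBipartition? B S T

  isBiclique-⊆ : ∀ {B B'} → B ⊆ B' → IsBiclique G B' → IsBiclique G B
  isBiclique-⊆ {B} B⊆B' (S , T , cover , disjoint , S-stable , T-stable , complete) =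
    S ∩ B , T ∩ B , cover′ ,
    (λ x s t → disjoint x (p∩q⊆p S B s) (p∩q⊆p T B t)) ,
    (λ x∈ y∈ → S-stable (p∩q⊆p S B x∈) (p∩q⊆p S B y∈)) ,
    (λ x∈ y∈ → T-stable (p∩q⊆p T B x∈) (p∩q⊆p T B y∈)) ,
    (λ x∈ y∈ → complete (p∩q⊆p S B x∈) (p∩q⊆p T B y∈))
    where
    cover′ : ∀ x → (x ∈ B → x ∈ S ∩ B ⊎ x ∈ T ∩ B) × (x ∈ S ∩ B ⊎ x ∈ T ∩ B → x ∈ B)
    cover′ x =
      (λ x∈B → [ (λ s → inj₁ (x∈p∩q⁺ (s , x∈B))) , (λ t → inj₂ (x∈p∩q⁺ (t , x∈B))) ]
                 (proj₁ (cover x) (B⊆B' x∈B))) ,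
      [ p∩q⊆q S B , p∩q⊆q T B ]

  isBiclique-preimage : ∀ {m} (g : Fin m → Fin n) {B} →
                        IsBiclique G B → IsBiclique (induce G g) (preimage g B)
  isBiclique-preimage g {B} (S , T , cover , disjoint , S-stable , T-stable , complete) =
    preimage g S , preimage g T , cover′ ,
    (λ x s t → disjoint (g x) (∈-preimage⁻ g s) (∈-preimage⁻ g t)) ,
    (λ x∈ y∈ → S-stable (∈-preimage⁻ g x∈) (∈-preimage⁻ g y∈)) ,
    (λ x∈ y∈ → T-stable (∈-preimage⁻ g x∈) (∈-preimage⁻ g y∈)) ,
    (λ x∈ y∈ → complete (∈-preimage⁻ g x∈) (∈-preimage⁻ g y∈))
    where
    cover′ : ∀ x → (x ∈ preimage g B → x ∈ preimage g S ⊎ x ∈ preimage g T) ×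
                   (x ∈ preimage g S ⊎ x ∈ preimage g T → x ∈ preimage g B)
    cover′ x =
      (λ x∈ → [ (λ s → inj₁ (∈-preimage⁺ g s)) , (λ t → inj₂ (∈-preimage⁺ g t)) ]
                (proj₁ (cover (g x)) (∈-preimage⁻ g x∈))) ,
      (λ st → ∈-preimage⁺ g (proj₂ (cover (g x))
                ([ (λ s → inj₁ (∈-preimage⁻ g s)) , (λ t → inj₂ (∈-preimage⁻ g t)) ] st)))

  isBiclique-image : ∀ {m} (g : Fin m → Fin n) → Injective _≡_ _≡_ g → ∀ {B} →
                     IsBiclique (induce G g) B → IsBiclique G (image g B)
  isBiclique-image g g-inj {B} (S , T , cover , disjoint , S-stable , T-stable , complete) =
    image g S , image g T , cover′ , disjoint′ , stable′ S-stable , stable′ T-stable , complete′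
    where
    cover′ : ∀ v → (v ∈ image g B → v ∈ image g S ⊎ v ∈ image g T) ×
                   (v ∈ image g S ⊎ v ∈ image g T → v ∈ image g B)
    cover′ v = split , join
      where
      split : v ∈ image g B → v ∈ image g S ⊎ v ∈ image g T
      split v∈ with ∈-image⁻ g v∈
      ... | y , y∈ , refl =
        [ (λ s → inj₁ (∈-image⁺ g s)) , (λ t → inj₂ (∈-image⁺ g t)) ] (proj₁ (cover y) y∈)
      join : v ∈ image g S ⊎ v ∈ image g T → v ∈ image g B
      join (inj₁ v∈) with ∈-image⁻ g v∈
      ... | y , y∈ , refl = ∈-image⁺ g (proj₂ (cover y) (inj₁ y∈))
      join (inj₂ v∈) with ∈-image⁻ g v∈
      ... | y , y∈ , refl = ∈-image⁺ g (proj₂ (cover y) (inj₂ y∈))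
    disjoint′ : ∀ v → v ∈ image g S → v ∈ image g T → ⊥
    disjoint′ v s t with ∈-image⁻ g s | ∈-image⁻ g t
    ... | y , y∈S , refl | z , z∈T , gz≡gy = disjoint y y∈S (subst (_∈ T) (g-inj gz≡gy) z∈T)
    stable′ : ∀ {P} → Stable (induce G g) P → Stable G (image g P)
    stable′ P-stable x∈ y∈ with ∈-image⁻ g x∈ | ∈-image⁻ g y∈
    ... | _ , x′∈ , refl | _ , y′∈ , refl = P-stable x′∈ y′∈
    complete′ : Complete (image g S) (image g T)
    complete′ x∈ y∈ with ∈-image⁻ g x∈ | ∈-image⁻ g y∈
    ... | _ , x′∈ , refl | _ , y′∈ , refl = complete x′∈ y′∈

  grow : ∀ B → IsBiclique G B → (vs : List (Fin n)) →
         ∃ λ N → IsBiclique G N × B ⊆ N ×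
                 (∀ {v} → v List.∈ vs → v ∈ N ⊎ ¬ IsBiclique G (N ∪ ⁅ v ⁆))
  grow B B-bic [] = B , B-bic , id , λ ()
  grow B B-bic (v ∷ vs) with isBiclique? (B ∪ ⁅ v ⁆)
  ... | yes Bv-bic =
    let (N , N-bic , Bv⊆N , settled) = grow (B ∪ ⁅ v ⁆) Bv-bic vs in
    N , N-bic , (λ x∈ → Bv⊆N (x∈p∪q⁺ (inj₁ x∈))) ,
    λ { (here refl) → inj₁ (Bv⊆N (x∈p∪q⁺ (inj₂ (x∈⁅x⁆ v)))) ; (there w∈) → settled w∈ }
  ... | no ¬Bv-bic =
    let (N , N-bic , B⊆N , settled) = grow B B-bic vs in
    N , N-bic , B⊆N ,
    λ { (here refl) → inj₂ (λ Nv-bic → ¬Bv-bic (isBiclique-⊆ (Bv⊆Nv B⊆N) Nv-bic))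
      ; (there w∈) → settled w∈ }
    where
    Bv⊆Nv : ∀ {N} → B ⊆ N → B ∪ ⁅ v ⁆ ⊆ N ∪ ⁅ v ⁆
    Bv⊆Nv B⊆N = ∪-⁅⁆-⊆ (λ x∈ → x∈p∪q⁺ (inj₁ (B⊆N x∈))) (x∈p∪q⁺ (inj₂ (x∈⁅x⁆ v)))

  biclique⊆maximal : ∀ {B} → IsBiclique G B → ∃ λ M → IsMaximalBiclique G M × B ⊆ M
  biclique⊆maximal {B} B-bic =
    let (N , N-bic , B⊆N , settled) = grow B B-bic (allFin n) in
    N , (N-bic , maximal settled) , B⊆N
    where
    maximal : ∀ {N} → (∀ {v} → v List.∈ allFin n → v ∈ N ⊎ ¬ IsBiclique G (N ∪ ⁅ v ⁆)) →
              ∀ B' → IsBiclique G B' → N ⊆ B' → B' ⊆ N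
    maximal settled B' B'-bic N⊆B' {v} v∈B' =
      [ id , (λ ¬Nv-bic → ⊥-elim (¬Nv-bic (isBiclique-⊆ (∪-⁅⁆-⊆ N⊆B' v∈B') B'-bic))) ]
        (settled (∈-allFin v))

  inducedBiclique⊆maximal : ∀ {m} {g : Fin m → Fin n} → Injective _≡_ _≡_ g → ∀ {B} →
                            IsBiclique (induce G g) B →
                            ∃ λ M → IsMaximalBiclique G M × B ⊆ preimage g M
  inducedBiclique⊆maximal {g = g} g-inj B-bic =
    let (M , M-max , gB⊆M) = biclique⊆maximal (isBiclique-image g g-inj B-bic) in
    M , M-max , λ y∈B → ∈-preimage⁺ g (gB⊆M (∈-image⁺ g y∈B))

  maximalInduced⇒trace : ∀ {m} {g : Fin m → Fin n} → Injective _≡_ _≡_ g → ∀ {N} →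
                         IsMaximalBiclique (induce G g) N →
                         ∃ λ M → IsMaximalBiclique G M × N ≡ preimage g M
  maximalInduced⇒trace {g = g} g-inj (N-bic , N-max) =
    let (M , M-max , N⊆gM) = inducedBiclique⊆maximal g-inj N-bic in
    M , M-max , ⊆-antisym N⊆gM (N-max _ (isBiclique-preimage g (proj₁ M-max)) N⊆gM)

hereditaryHelly⇒hereditaryBicliqueHelly :
  ∀ {n p q} → 1 ≤ p → 1 ≤ q → (G : Graph n) →
  HereditaryHelly p q (𝓑 G) → HereditaryBicliqueHelly p q G
hereditaryHelly⇒hereditaryBicliqueHelly 1≤p 1≤q G 𝓑-helly m f f-inj F F⊆ F-nonempty F-int =
  𝓑-helly m f f-inj F F⊆traces F-nonempty F-int
  where
  F⊆traces : ∀ A → F A → inducedEdges f (𝓑 G) A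
  F⊆traces A FA = maximalInduced⇒trace G f-inj (F⊆ A FA) , intersecting⇒nonempty 1≤p 1≤q F-int FA

module HereditaryBicliqueHelly⇒Helly
  {n p q} (1≤p : 1 ≤ p) (1≤q : 1 ≤ q) (G : Graph n) (helly : HereditaryBicliqueHelly p q G)
  {m} (f : Fin m → Fin n) (f-inj : Injective _≡_ _≡_ f)
  (F : Family m) (F⊆traces : ∀ A → F A → inducedEdges f (𝓑 G) A)
  (F-nonempty : ∃ F) (F-int : Intersecting p q F) where

  Supporting : Family n
  Supporting M = IsMaximalBiclique G M × ∃ λ A → F A × (∀ {x} → x ∈ A → f x ∈ M)

  support : ∀ {M} → Supporting M → Subset m
  support (_ , A , _) = A

  support∈F : ∀ {M} (sM : Supporting M) → F (support sM)
  support∈F (_ , _ , FA , _) = FA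

  supporting-trace : ∀ {A} → F A → ∃ λ M → Supporting M × A ≡ preimage f M
  supporting-trace {A} FA with F⊆traces A FA
  ... | (M , M-max , refl) , _ = M , (M-max , A , FA , ∈-preimage⁻ f) , refl

  -- The vertex sets W of the proof idea, presented as images of injections embed.
  record Admissible (k : ℕ) : Set where
    field
      embed : Fin k → Fin n
      embed-injective : Injective _≡_ _≡_ embed
      lift : Fin m → Fin k
      embed∘lift : ∀ x → embed (lift x) ≡ f x
      outside⊆supporting : ∀ {v} → (∀ y → embed y ≢ v) → ∀ {M} → Supporting M → v ∈ M

  module _ {k} (W : Admissible k) where
    open Admissible W

    lift-injective : Injective _≡_ _≡_ lift
    lift-injective {x} {x′} e =
      f-inj (trans (sym (embed∘lift x)) (trans (cong embed e) (embed∘lift x′)))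

    lift∈trace : ∀ {M} (sM : Supporting M) {x} → x ∈ support sM → lift x ∈ preimage embed M
    lift∈trace {M} (_ , _ , _ , fA⊆M) {x} x∈A =
      ∈-preimage⁺ embed (subst (_∈ M) (sym (embed∘lift x)) (fA⊆M x∈A))

    trace-maximal : ∀ {M} → Supporting M → IsMaximalBiclique (induce G embed) (preimage embed M)
    trace-maximal {M} ((M-bic , M-maximal) , A , FA , fA⊆M) =
      isBiclique-preimage G embed M-bic , maximal
      where
      maximal : ∀ B → IsBiclique (induce G embed) B → preimage embed M ⊆ B → B ⊆ preimage embed M
      maximal B B-bic M⊆B with inducedBiclique⊆maximal G embed-injective B-bic
      ... | N , N-max , B⊆N = λ y∈B → ∈-preimage⁺ embed (N⊆M (∈-preimage⁻ embed (B⊆N y∈B)))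
        where
        inside : ∀ {y} → embed y ∈ M → embed y ∈ N
        inside ey∈M = ∈-preimage⁻ embed (B⊆N (M⊆B (∈-preimage⁺ embed ey∈M)))
        N-supporting : Supporting N
        N-supporting = N-max , A , FA , λ {x} x∈A →
          subst (_∈ N) (embed∘lift x) (inside (subst (_∈ M) (sym (embed∘lift x)) (fA⊆M x∈A)))
        M⊆N : M ⊆ N
        M⊆N {v} v∈M with any? (λ y → embed y ≟ v)
        ... | yes (y , refl) = inside v∈M
        ... | no ∉W = outside⊆supporting (λ y e → ∉W (y , e)) N-supporting
        N⊆M : N ⊆ M
        N⊆M = M-maximal N (proj₁ N-max) M⊆N

    Traces : Family k
    Traces B = ∃ λ M → Supporting M × B ≡ preimage embed M

    traces-intersecting : Intersecting p q Traces
    traces-intersecting l 1≤l l≤p B B-traces =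
      atLeast-map {Q = λ y → ∀ i → y ∈ B i} lift lift-injective lift∈B (F-int l 1≤l l≤p A FA)
      where
      A : Fin l → Subset m
      A i = support (proj₁ (proj₂ (B-traces i)))
      FA : ∀ i → F (A i)
      FA i = support∈F (proj₁ (proj₂ (B-traces i)))
      lift∈B : ∀ {x} → (∀ i → x ∈ A i) → ∀ i → lift x ∈ B i
      lift∈B {x} x∈A i =
        let (M , sM , B≡) = B-traces i in subst (lift x ∈_) (sym B≡) (lift∈trace sM (x∈A i))

    traces-core : AtLeast q (core Traces)
    traces-core = helly k embed embed-injective Traces trace⇒maximal some-trace traces-intersecting
      where
      trace⇒maximal : ∀ B → Traces B → IsMaximalBiclique (induce G embed) B
      trace⇒maximal _ (_ , sM , refl) = trace-maximal sM
      some-trace : ∃ Traces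
      some-trace = let (M , sM , _) = supporting-trace (proj₂ F-nonempty) in
                   preimage embed M , M , sM , refl

    liftedCore⊆core : ∀ {x} → core Traces (lift x) → core F x
    liftedCore⊆core {x} x∈core A FA =
      let (M , sM , A≡) = supporting-trace FA in
      subst (x ∈_) (sym A≡) (∈-preimage⁺ f (subst (_∈ M) (embed∘lift x)
        (∈-preimage⁻ embed (x∈core (preimage embed M) (M , sM , refl)))))

  -- A common vertex of the traces lies in every supporting maximal biclique.
  shrink : ∀ {k} (W : Admissible (suc k)) (y : Fin (suc k)) → core (Traces W) y →
           (∀ x → Admissible.lift W x ≢ y) → Admissible k
  shrink W y y∈core y∉lift = record
    { embed = λ z → embed (punchIn y z)
    ; embed-injective = λ e → punchIn-injective y _ _ (embed-injective e)
    ; lift = λ x → punchOut (y≢lift x)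
    ; embed∘lift = λ x → trans (cong embed (punchIn-punchOut (y≢lift x))) (embed∘lift x)
    ; outside⊆supporting = outside⊆supporting′
    }
    where
    open Admissible W
    y≢lift : ∀ x → y ≢ lift x
    y≢lift x e = y∉lift x (sym e)
    outside⊆supporting′ : ∀ {v} → (∀ z → embed (punchIn y z) ≢ v) → ∀ {M} → Supporting M → v ∈ M
    outside⊆supporting′ {v} ∉W′ {M} sM with v ≟ embed y
    ... | yes refl = ∈-preimage⁻ embed (y∈core (preimage embed M) (M , sM , refl))
    ... | no v≢ey = outside⊆supporting ∉W sM
      where
      ∉W : ∀ z → embed z ≢ v
      ∉W z ez≡v with y ≟ z
      ... | yes refl = v≢ey (sym ez≡v)
      ... | no y≢z = ∉W′ (punchOut y≢z) (trans (cong embed (punchIn-punchOut y≢z)) ez≡v)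

  admissible-vertex : ∀ {k} → Admissible k → Fin k
  admissible-vertex W =
    let (A , FA) = F-nonempty
        (x , _) = intersecting⇒nonempty {F = F} 1≤p 1≤q F-int FA
    in Admissible.lift W x

  whole : Admissible n
  whole = record
    { embed = id
    ; embed-injective = id
    ; lift = f
    ; embed∘lift = λ _ → refl
    ; outside⊆supporting = λ ∉V → ⊥-elim (∉V _ refl)
    }

  admissible⇒core : ∀ {k} → Admissible k → AtLeast q (core F)
  admissible⇒core {zero} W with admissible-vertex W
  ... | ()
  admissible⇒core {suc k} W
    with traces-core W
  ... | L@(h , _ , h-core)
    with all? (λ i → any? (λ x → Admissible.lift W x ≟ h i))
  ... | yes lifted = atLeast-pullback {P = core (Traces W)} (Admissible.lift W) (liftedCore⊆core W) L lifted
  ... | no ¬lifted =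
    let (i , ¬lift) = ¬∀⟶∃¬ _ _ (λ i → any? (λ x → Admissible.lift W x ≟ h i)) ¬lifted in
    admissible⇒core (shrink W (h i) (h-core i) (λ x e → ¬lift (x , e)))

  core-atLeast : AtLeast q (core F)
  core-atLeast = admissible⇒core whole

hereditaryBicliqueHelly⇒hereditaryHelly :
  ∀ {n p q} → 1 ≤ p → 1 ≤ q → (G : Graph n) →
  HereditaryBicliqueHelly p q G → HereditaryHelly p q (𝓑 G)
hereditaryBicliqueHelly⇒hereditaryHelly 1≤p 1≤q G helly m f f-inj F F⊆ F-nonempty F-int =
  HereditaryBicliqueHelly⇒Helly.core-atLeast 1≤p 1≤q G helly f f-inj F F⊆ F-nonempty F-int

corollary4p15 : (p q : ℕ) → 1 ≤ p → 1 ≤ q → (n : ℕ) → (G : Graph n) →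
    HereditaryBicliqueHelly p q G ⇔ HereditaryHelly p q (𝓑 G)
corollary4p15 p q 1≤p 1≤q n G =
  mk⇔ (hereditaryBicliqueHelly⇒hereditaryHelly 1≤p 1≤q G)
      (hereditaryHelly⇒hereditaryBicliqueHelly 1≤p 1≤q G)
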